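{- Let $\mathcal L$ be a canonically summable cartesian symmetric monoidal category. Then $I=1\& 1$, equipped with the counit $\mathrm{pr}_0\in\mathcal L(I,1)$ and the comultiplication $\mathsf L\in\mathcal L(I,I\otimes I)$, is a cocommutative comonoid in $\mathcal L$.
   Context: $\mathcal L$ is a symmetric monoidal category (unit $1$, right unitor $\rho$) enriched over pointed sets (zero morphisms absorbing for composition and tensor), with finite products $\&$ and projections $\mathrm{pr}_0,\mathrm{pr}_1$, in which $I=1\& 1$ is exponentiable with right adjoint $S=I\multimap-$ to $-\otimes I$ and evaluation $\mathrm{ev}$. Let $w_0=\langle\mathrm{id}_1,0\rangle$, $w_1=\langle0,\mathrm{id}_1\rangle$, $\Delta=\langle\mathrm{id}_1,\mathrm{id}_1\rangle$; for $\phi\in\mathcal L(1,I)$ let $\bar\phi_X=\mathrm{ev}\circ((I\multimap X)\otimes\phi)\circ\rho^{ -1}$. $\mathcal L$ is canonically summable when $(S,\bar w_0,\bar w_1,\bar\Delta)$ is a summability structure: $\pi_i:=\bar w_i$ jointly monic, and with "$f_0,f_1$ summable" meaning there is a (unique) $\langle f_0,f_1\rangle_S$ with $\pi_i\langle f_0,f_1\rangle_S=f_i$ and $f_0+f_1=\bar\Delta\circ\langle f_0,f_1\rangle_S$, the axioms (S-com), (S-zero), (S-witness), (S-assoc) hold (commutativity of the partial sum, $f+0=f$, summability of witnesses of summable pairs whose sums are summable, and $S\sigma\circ c=\sigma_S$ for the flip $c$). In a canonically summable category, $(w_0\otimes w_0)\rho^{ -1}$, $(w_0\otimes w_1)\rho^{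 -1}$, $(w_1\otimes w_0)\rho^{ -1}\in\mathcal L(1,I\otimes I)$ are summable and $\mathsf L\in\mathcal L(I,I\otimes I)$ denotes the unique morphism with $\mathsf L\circ w_0=(w_0\otimes w_0)\circ\rho^{ -1}$ and $\mathsf L\circ w_1=(w_0\otimes w_1)\circ\rho^{ -1}+(w_1\otimes w_0)\circ\rho^{ -1}$. -}

module Defs where

open import Level using (Level; _⊔_) renaming (suc to lsuc)
open import Relation.Binary.PropositionalEquality using (_≡_)
open import Data.Product using (Σ; _×_; _,_; proj₁)

record Setting (o ℓ : Level) : Set (lsuc (o ⊔ ℓ)) where
  infixr 9 _∘_
  infixr 10 _⊗₁_
  infixr 10 _⊗₀_
  infix 4 _⇒_
  field
    Obj : Set o
    _⇒_ : Obj → Obj → Set ℓ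
    id  : ∀ {A} → A ⇒ A
    _∘_ : ∀ {A B C} → B ⇒ C → A ⇒ B → A ⇒ C
    identityˡ : ∀ {A B} {f : A ⇒ B} → id ∘ f ≡ f
    identityʳ : ∀ {A B} {f : A ⇒ B} → f ∘ id ≡ f
    assoc : ∀ {A B C D} {f : A ⇒ B} {g : B ⇒ C} {h : C ⇒ D} →
            (h ∘ g) ∘ f ≡ h ∘ (g ∘ f)
    𝟙 : Obj
    _⊗₀_ : Obj → Obj → Obj
    _⊗₁_ : ∀ {A B C D} → A ⇒ B → C ⇒ D → (A ⊗₀ C) ⇒ (B ⊗₀ D)
    ⊗-id : ∀ {A B} → (id {A} ⊗₁ id {B}) ≡ id
    ⊗-∘ : ∀ {A B C D E F} {f : B ⇒ C} {g : A ⇒ B} {h : E ⇒ F} {k : D ⇒ E} →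
          ((f ∘ g) ⊗₁ (h ∘ k)) ≡ (f ⊗₁ h) ∘ (g ⊗₁ k)
    α⇒ : ∀ {A B C} → ((A ⊗₀ B) ⊗₀ C) ⇒ (A ⊗₀ (B ⊗₀ C))
    α⇐ : ∀ {A B C} → (A ⊗₀ (B ⊗₀ C)) ⇒ ((A ⊗₀ B) ⊗₀ C)
    α-isoˡ : ∀ {A B C} → α⇐ {A} {B} {C} ∘ α⇒ ≡ id
    α-isoʳ : ∀ {A B C} → α⇒ {A} {B} {C} ∘ α⇐ ≡ id
    α-natural : ∀ {A B C D E F} {f : A ⇒ D} {g : B ⇒ E} {h : C ⇒ F} →
                α⇒ ∘ ((f ⊗₁ g) ⊗₁ h) ≡ (f ⊗₁ (g ⊗₁ h)) ∘ α⇒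
    lu⇒ : ∀ {A} → (𝟙 ⊗₀ A) ⇒ A
    lu⇐ : ∀ {A} → A ⇒ (𝟙 ⊗₀ A)
    lu-isoˡ : ∀ {A} → lu⇐ {A} ∘ lu⇒ ≡ id
    lu-isoʳ : ∀ {A} → lu⇒ {A} ∘ lu⇐ ≡ id
    lu-natural : ∀ {A B} {f : A ⇒ B} → lu⇒ ∘ (id ⊗₁ f) ≡ f ∘ lu⇒
    ru⇒ : ∀ {A} → (A ⊗₀ 𝟙) ⇒ A
    ru⇐ : ∀ {A} → A ⇒ (A ⊗₀ 𝟙)
    ru-isoˡ : ∀ {A} → ru⇐ {A} ∘ ru⇒ ≡ id
    ru-isoʳ : ∀ {A} → ru⇒ {A} ∘ ru⇐ ≡ id
    ru-natural : ∀ {A B} {f : A ⇒ B} → ru⇒ ∘ (f ⊗₁ id) ≡ f ∘ ru⇒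
    triangle : ∀ {A B} → (id {A} ⊗₁ lu⇒ {B}) ∘ α⇒ ≡ (ru⇒ ⊗₁ id)
    pentagon : ∀ {A B C D} →
               (id {A} ⊗₁ α⇒ {B} {C} {D}) ∘ (α⇒ ∘ (α⇒ ⊗₁ id)) ≡ α⇒ ∘ α⇒
    braid : ∀ {A B} → (A ⊗₀ B) ⇒ (B ⊗₀ A)
    braid-natural : ∀ {A B C D} {f : A ⇒ C} {g : B ⇒ D} →
                    braid ∘ (f ⊗₁ g) ≡ (g ⊗₁ f) ∘ braid
    braid-symmetric : ∀ {A B} → braid {B} {A} ∘ braid {A} {B} ≡ id
    hexagon : ∀ {A B C} →
              α⇒ {B} {C} {A} ∘ (braid ∘ α⇒) ≡ (id ⊗₁ braid) ∘ (α⇒ ∘ (braid ⊗₁ id))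
    -- enrichment over pointed sets
    0# : ∀ {A B} → A ⇒ B
    0-∘ : ∀ {A B C} {f : A ⇒ B} → 0# {B} {C} ∘ f ≡ 0#
    ∘-0 : ∀ {A B C} {f : B ⇒ C} → f ∘ 0# {A} {B} ≡ 0#
    0-⊗ : ∀ {A B C D} {f : C ⇒ D} → (0# {A} {B} ⊗₁ f) ≡ 0#
    ⊗-0 : ∀ {A B C D} {f : A ⇒ B} → (f ⊗₁ 0# {C} {D}) ≡ 0#
    ⊤ : Obj
    ! : ∀ {A} → A ⇒ ⊤
    !-unique : ∀ {A} (f : A ⇒ ⊤) → f ≡ !
    _&_ : Obj → Obj → Obj
    pr₀ : ∀ {A B} → (A & B) ⇒ A
    pr₁ : ∀ {A B} → (A & B) ⇒ B
    ⟨_,_⟩ : ∀ {A B C} → C ⇒ A → C ⇒ B → C ⇒ (A & B)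
    pr₀-β : ∀ {A B C} {f : C ⇒ A} {g : C ⇒ B} → pr₀ ∘ ⟨ f , g ⟩ ≡ f
    pr₁-β : ∀ {A B C} {f : C ⇒ A} {g : C ⇒ B} → pr₁ ∘ ⟨ f , g ⟩ ≡ g
    ⟨⟩-unique : ∀ {A B C} {f : C ⇒ A} {g : C ⇒ B} (h : C ⇒ (A & B)) →
                pr₀ ∘ h ≡ f → pr₁ ∘ h ≡ g → h ≡ ⟨ f , g ⟩
    -- I = 1 & 1 is exponentiable: S = I ⊸ - is right adjoint to - ⊗ I
    S : Obj → Obj
    ev : ∀ {X} → (S X ⊗₀ (𝟙 & 𝟙)) ⇒ X
    curry : ∀ {X Y} → (Y ⊗₀ (𝟙 & 𝟙)) ⇒ X → Y ⇒ S X
    ev-curry : ∀ {X Y} {f : (Y ⊗₀ (𝟙 & 𝟙)) ⇒ X} → ev ∘ (curry f ⊗₁ id) ≡ f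
    curry-unique : ∀ {X Y} {f : (Y ⊗₀ (𝟙 & 𝟙)) ⇒ X} (g : Y ⇒ S X) →
                   ev ∘ (g ⊗₁ id) ≡ f → g ≡ curry f

module Derived {o ℓ} (𝓛 : Setting o ℓ) where
  open Setting 𝓛

  I : Obj
  I = 𝟙 & 𝟙

  w₀ w₁ Δ : 𝟙 ⇒ I
  w₀ = ⟨ id , 0# ⟩
  w₁ = ⟨ 0# , id ⟩
  Δ  = ⟨ id , id ⟩

  bar : (φ : 𝟙 ⇒ I) → ∀ {X} → S X ⇒ X
  bar φ = ev ∘ ((id ⊗₁ φ) ∘ ru⇐)

  S₁ : ∀ {X Y} → X ⇒ Y → S X ⇒ S Y
  S₁ f = curry (f ∘ ev)

  π₀ π₁ σ : ∀ {X} → S X ⇒ X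
  π₀ = bar w₀
  π₁ = bar w₁
  σ  = bar Δ

  IsWitness : ∀ {X Y} → X ⇒ Y → X ⇒ Y → X ⇒ S Y → Set ℓ
  IsWitness f₀ f₁ h = (π₀ ∘ h ≡ f₀) × (π₁ ∘ h ≡ f₁)

  Summable : ∀ {X Y} → X ⇒ Y → X ⇒ Y → Set ℓ
  Summable {X} {Y} f₀ f₁ = Σ (X ⇒ S Y) (IsWitness f₀ f₁)

  sum : ∀ {X Y} {f₀ f₁ : X ⇒ Y} → Summable f₀ f₁ → X ⇒ Y
  sum (h , _) = σ ∘ h

  record CanonicallySummable : Set (o ⊔ ℓ) where
    field
      π-jointly-monic : ∀ {X Y} {f g : X ⇒ S Y} →
                        π₀ ∘ f ≡ π₀ ∘ g → π₁ ∘ f ≡ π₁ ∘ g → f ≡ g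
      S-com : ∀ {X Y} {f₀ f₁ : X ⇒ Y} (s : Summable f₀ f₁) →
              Σ (Summable f₁ f₀) (λ s′ → sum s ≡ sum s′)
      S-zero : ∀ {X Y} (f : X ⇒ Y) →
               Σ (Summable f 0#) (λ s → sum s ≡ f)
      S-witness : ∀ {X Y} {f₀₀ f₀₁ f₁₀ f₁₁ : X ⇒ Y}
                  (s₀ : Summable f₀₀ f₀₁) (s₁ : Summable f₁₀ f₁₁) →
                  Summable (sum s₀) (sum s₁) →
                  Summable (proj₁ s₀) (proj₁ s₁)
      S-assoc : ∀ {X} →
                Σ (Summable (S₁ (π₀ {X})) (S₁ (π₁ {X})))
                  (λ c → S₁ (σ {X}) ∘ proj₁ c ≡ σ {S X})

  record IsCocommutativeComonoid (C : Obj) (ε : C ⇒ 𝟙) (δ : C ⇒ (C ⊗₀ C)) : Set ℓ where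
    field
      counitˡ : lu⇒ ∘ ((ε ⊗₁ id) ∘ δ) ≡ id
      counitʳ : ru⇒ ∘ ((id ⊗₁ ε) ∘ δ) ≡ id
      coassoc : α⇒ ∘ ((δ ⊗₁ id) ∘ δ) ≡ (id ⊗₁ δ) ∘ δ
      cocomm  : braid ∘ δ ≡ δ

  IsL : (𝖫 : I ⇒ (I ⊗₀ I)) →
        Summable ((w₀ ⊗₁ w₁) ∘ ru⇐) ((w₁ ⊗₁ w₀) ∘ ru⇐) → Set ℓ
  IsL 𝖫 s = (𝖫 ∘ w₀ ≡ (w₀ ⊗₁ w₀) ∘ ru⇐) × (𝖫 ∘ w₁ ≡ sum s)

-- A morphism out of I = 1 & 1 is determined by its restrictions along w₀ and w₁:
-- curry (f ∘ λ) has projections f ∘ w₀ and f ∘ w₁, and the projections of S are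
-- jointly monic.  Along w₀ the comultiplication is the point w₀ ⊗ w₀, on which
-- all comonoid laws reduce to monoidal coherence.  Along w₁ it is the sum
-- w₀ ⊗ w₁ + w₁ ⊗ w₀, and each law becomes an identity between finite sums of
-- points of I ⊗ I or I ⊗ (I ⊗ I): unit laws by (S-zero), cocommutativity by
-- (S-com), coassociativity by associativity of the partial sum, which follows
-- from (S-witness), (S-com), (S-zero) and naturality of σ.
module Submission where

open import Defs
open import Relation.Binary.PropositionalEquality
open import Data.Product using (Σ; ∃; _×_; _,_; proj₁; proj₂)

module MonoidalProperties {o ℓ} (𝓛 : Setting o ℓ) where
  open Setting 𝓛
  open ≡-Reasoning

  pullˡ : ∀ {A B C D} {a : C ⇒ D} {b : B ⇒ C} {c : B ⇒ D} {f : A ⇒ B} →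
          a ∘ b ≡ c → a ∘ (b ∘ f) ≡ c ∘ f
  pullˡ {f = f} p = trans (sym assoc) (cong (_∘ f) p)

  pullʳ : ∀ {A B C D} {a : C ⇒ D} {b : B ⇒ C} {c : A ⇒ B} {d : A ⇒ C} →
          b ∘ c ≡ d → (a ∘ b) ∘ c ≡ a ∘ d
  pullʳ {a = a} p = trans assoc (cong (a ∘_) p)

  ⊗-merge : ∀ {A B C D E F} {f : B ⇒ C} {g : A ⇒ B} {h : E ⇒ F} {k : D ⇒ E} →
            (f ⊗₁ h) ∘ (g ⊗₁ k) ≡ (f ∘ g) ⊗₁ (h ∘ k)
  ⊗-merge = sym ⊗-∘

  ⊗-splitˡ : ∀ {A B C D} {f : A ⇒ B} {g : C ⇒ D} → (f ⊗₁ id) ∘ (id ⊗₁ g) ≡ f ⊗₁ g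
  ⊗-splitˡ = trans ⊗-merge (cong₂ _⊗₁_ identityʳ identityˡ)

  ⊗-splitʳ : ∀ {A B C D} {f : A ⇒ B} {g : C ⇒ D} → (id ⊗₁ g) ∘ (f ⊗₁ id) ≡ f ⊗₁ g
  ⊗-splitʳ = trans ⊗-merge (cong₂ _⊗₁_ identityˡ identityʳ)

  retraction-cancelʳ : ∀ {A B C} {f g : B ⇒ C} {p : A ⇒ B} {q : B ⇒ A} →
                       p ∘ q ≡ id → f ∘ p ≡ g ∘ p → f ≡ g
  retraction-cancelʳ {f = f} {g} {p} {q} pq e = begin
    f            ≡⟨ sym identityʳ ⟩
    f ∘ id       ≡⟨ cong (f ∘_) (sym pq) ⟩
    f ∘ (p ∘ q)  ≡⟨ pullˡ e ⟩
    (g ∘ p) ∘ q  ≡⟨ pullʳ pq ⟩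
    g ∘ id       ≡⟨ identityʳ ⟩
    g            ∎

  section-cancelˡ : ∀ {A B C} {f g : A ⇒ B} {p : B ⇒ C} {q : C ⇒ B} →
                    q ∘ p ≡ id → p ∘ f ≡ p ∘ g → f ≡ g
  section-cancelˡ {f = f} {g} {p} {q} qp e = begin
    f            ≡⟨ sym identityˡ ⟩
    id ∘ f       ≡⟨ cong (_∘ f) (sym qp) ⟩
    (q ∘ p) ∘ f  ≡⟨ pullʳ e ⟩
    q ∘ (p ∘ g)  ≡⟨ pullˡ qp ⟩
    id ∘ g       ≡⟨ identityˡ ⟩
    g            ∎

  inverse-natural : ∀ {A B X Y} {i : X ⇒ A} {j : A ⇒ X} {i′ : Y ⇒ B} {j′ : B ⇒ Y}
                    {f : A ⇒ B} {g : X ⇒ Y} →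
                    j′ ∘ i′ ≡ id → i ∘ j ≡ id → i′ ∘ g ≡ f ∘ i → j′ ∘ f ≡ g ∘ j
  inverse-natural {i = i} {j} {i′} {j′} {f} {g} ji ij nat = begin
    j′ ∘ f                ≡⟨ sym identityʳ ⟩
    (j′ ∘ f) ∘ id         ≡⟨ cong ((j′ ∘ f) ∘_) (sym ij) ⟩
    (j′ ∘ f) ∘ (i ∘ j)    ≡⟨ pullʳ (sym assoc) ⟩
    j′ ∘ ((f ∘ i) ∘ j)    ≡⟨ cong (λ x → j′ ∘ (x ∘ j)) (sym nat) ⟩
    j′ ∘ ((i′ ∘ g) ∘ j)   ≡⟨ cong (j′ ∘_) assoc ⟩
    j′ ∘ (i′ ∘ (g ∘ j))   ≡⟨ pullˡ ji ⟩
    id ∘ (g ∘ j)          ≡⟨ identityˡ ⟩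
    g ∘ j                 ∎

  ru⇐-natural : ∀ {A B} {f : A ⇒ B} → ru⇐ ∘ f ≡ (f ⊗₁ id) ∘ ru⇐
  ru⇐-natural = inverse-natural ru-isoˡ ru-isoʳ ru-natural

  lu⇐-natural : ∀ {A B} {f : A ⇒ B} → lu⇐ ∘ f ≡ (id ⊗₁ f) ∘ lu⇐
  lu⇐-natural = inverse-natural lu-isoˡ lu-isoʳ lu-natural

  id⊗-injective : ∀ {A B} {f g : A ⇒ B} → id {𝟙} ⊗₁ f ≡ id ⊗₁ g → f ≡ g
  id⊗-injective {f = f} {g} e = retraction-cancelʳ lu-isoʳ (begin
    f ∘ lu⇒           ≡⟨ sym lu-natural ⟩
    lu⇒ ∘ (id ⊗₁ f)   ≡⟨ cong (lu⇒ ∘_) e ⟩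
    lu⇒ ∘ (id ⊗₁ g)   ≡⟨ lu-natural ⟩
    g ∘ lu⇒           ∎)

  ⊗id-injective : ∀ {A B} {f g : A ⇒ B} → f ⊗₁ id {𝟙} ≡ g ⊗₁ id → f ≡ g
  ⊗id-injective {f = f} {g} e = retraction-cancelʳ ru-isoʳ (begin
    f ∘ ru⇒           ≡⟨ sym ru-natural ⟩
    ru⇒ ∘ (f ⊗₁ id)   ≡⟨ cong (ru⇒ ∘_) e ⟩
    ru⇒ ∘ (g ⊗₁ id)   ≡⟨ ru-natural ⟩
    g ∘ ru⇒           ∎)

  -- Kelly: both sides agree after whiskering with 𝟙 and precomposing with the
  -- invertible α⇒ ∘ (α⇒ ⊗₁ id), by the pentagon and the triangle.
  lu-assoc : ∀ {X Y} → lu⇒ {X ⊗₀ Y} ∘ α⇒ {𝟙} {X} {Y} ≡ lu⇒ ⊗₁ id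
  lu-assoc {X} {Y} = id⊗-injective (retraction-cancelʳ αα-section (trans viaPentagon (sym viaTriangle)))
    where
    αα-section : (α⇒ {𝟙} {𝟙 ⊗₀ X} {Y} ∘ (α⇒ {𝟙} {𝟙} {X} ⊗₁ id)) ∘ ((α⇐ ⊗₁ id) ∘ α⇐) ≡ id
    αα-section = begin
      (α⇒ ∘ (α⇒ ⊗₁ id)) ∘ ((α⇐ ⊗₁ id) ∘ α⇐)
        ≡⟨ pullʳ (pullˡ (trans ⊗-merge (trans (cong₂ _⊗₁_ α-isoʳ identityˡ) ⊗-id))) ⟩
      α⇒ ∘ (id ∘ α⇐)  ≡⟨ cong (α⇒ ∘_) identityˡ ⟩
      α⇒ ∘ α⇐         ≡⟨ α-isoʳ ⟩
      id              ∎
    viaPentagon : (id ⊗₁ (lu⇒ ∘ α⇒)) ∘ (α⇒ ∘ (α⇒ ⊗₁ id)) ≡ α⇒ ∘ ((ru⇒ ⊗₁ id) ⊗₁ id {Y})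
    viaPentagon = begin
      (id ⊗₁ (lu⇒ ∘ α⇒)) ∘ (α⇒ ∘ (α⇒ ⊗₁ id))
        ≡⟨ cong (_∘ (α⇒ ∘ (α⇒ ⊗₁ id))) (trans (cong (_⊗₁ _) (sym identityˡ)) ⊗-∘) ⟩
      ((id ⊗₁ lu⇒) ∘ (id ⊗₁ α⇒)) ∘ (α⇒ ∘ (α⇒ ⊗₁ id))  ≡⟨ pullʳ pentagon ⟩
      (id ⊗₁ lu⇒) ∘ (α⇒ ∘ α⇒)                          ≡⟨ pullˡ triangle ⟩
      (ru⇒ ⊗₁ id) ∘ α⇒                                 ≡⟨ cong (λ z → (ru⇒ ⊗₁ z) ∘ α⇒) (sym ⊗-id) ⟩
      (ru⇒ ⊗₁ (id ⊗₁ id)) ∘ α⇒                         ≡⟨ sym α-natural ⟩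
      α⇒ ∘ ((ru⇒ ⊗₁ id) ⊗₁ id)                         ∎
    viaTriangle : (id ⊗₁ (lu⇒ ⊗₁ id)) ∘ (α⇒ ∘ (α⇒ ⊗₁ id)) ≡ α⇒ ∘ ((ru⇒ ⊗₁ id) ⊗₁ id {Y})
    viaTriangle = begin
      (id ⊗₁ (lu⇒ ⊗₁ id)) ∘ (α⇒ ∘ (α⇒ ⊗₁ id))    ≡⟨ sym assoc ⟩
      ((id ⊗₁ (lu⇒ ⊗₁ id)) ∘ α⇒) ∘ (α⇒ ⊗₁ id)    ≡⟨ cong (_∘ (α⇒ ⊗₁ id)) (sym α-natural) ⟩
      (α⇒ ∘ ((id ⊗₁ lu⇒) ⊗₁ id)) ∘ (α⇒ ⊗₁ id)    ≡⟨ pullʳ ⊗-merge ⟩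
      α⇒ ∘ (((id ⊗₁ lu⇒) ∘ α⇒) ⊗₁ (id ∘ id))     ≡⟨ cong (α⇒ ∘_) (cong₂ _⊗₁_ triangle identityˡ) ⟩
      α⇒ ∘ ((ru⇒ ⊗₁ id) ⊗₁ id)                   ∎

  lu-𝟙⊗ : ∀ {A} → lu⇒ {𝟙 ⊗₀ A} ≡ id ⊗₁ lu⇒
  lu-𝟙⊗ = sym (section-cancelˡ lu-isoˡ lu-natural)

  lu≡ru : lu⇒ {𝟙} ≡ ru⇒
  lu≡ru = sym (⊗id-injective (begin
    ru⇒ ⊗₁ id         ≡⟨ sym triangle ⟩
    (id ⊗₁ lu⇒) ∘ α⇒  ≡⟨ cong (_∘ α⇒) (sym lu-𝟙⊗) ⟩
    lu⇒ ∘ α⇒          ≡⟨ lu-assoc ⟩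
    lu⇒ ⊗₁ id         ∎))

  lu⇐≡ru⇐ : lu⇐ {𝟙} ≡ ru⇐
  lu⇐≡ru⇐ = begin
    lu⇐                ≡⟨ sym identityʳ ⟩
    lu⇐ ∘ id           ≡⟨ cong (lu⇐ ∘_) (sym ru-isoʳ) ⟩
    lu⇐ ∘ (ru⇒ ∘ ru⇐)  ≡⟨ pullˡ (trans (cong (lu⇐ ∘_) (sym lu≡ru)) lu-isoˡ) ⟩
    id ∘ ru⇐           ≡⟨ identityˡ ⟩
    ru⇐                ∎

  lu⇒∘ru⇐ : lu⇒ {𝟙} ∘ ru⇐ ≡ id
  lu⇒∘ru⇐ = trans (cong (_∘ ru⇐) lu≡ru) ru-isoʳ

  -- Cancelling the braiding in the hexagon at (A, 𝟙, 𝟙) and applying Kelly's lemma.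
  lu∘braid : ∀ {A} → lu⇒ ∘ braid {A} {𝟙} ≡ ru⇒
  lu∘braid {A} = sym (⊗id-injective (section-cancelˡ braid-symmetric
                   (trans (sym leftSide) (trans (cong (lu⇒ ∘_) hexagon) rightSide))))
    where
    leftSide : lu⇒ ∘ (α⇒ ∘ (braid ∘ α⇒)) ≡ braid ∘ (ru⇒ {A} ⊗₁ id {𝟙})
    leftSide = begin
      lu⇒ ∘ (α⇒ ∘ (braid ∘ α⇒))       ≡⟨ pullˡ lu-assoc ⟩
      (lu⇒ ⊗₁ id) ∘ (braid ∘ α⇒)      ≡⟨ sym assoc ⟩
      ((lu⇒ ⊗₁ id) ∘ braid) ∘ α⇒      ≡⟨ cong (_∘ α⇒) (sym braid-natural) ⟩
      (braid ∘ (id ⊗₁ lu⇒)) ∘ α⇒      ≡⟨ pullʳ triangle ⟩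
      braid ∘ (ru⇒ ⊗₁ id)             ∎
    rightSide : lu⇒ ∘ ((id ⊗₁ braid) ∘ (α⇒ ∘ (braid ⊗₁ id))) ≡ braid ∘ ((lu⇒ ∘ braid {A} {𝟙}) ⊗₁ id {𝟙})
    rightSide = begin
      lu⇒ ∘ ((id ⊗₁ braid) ∘ (α⇒ ∘ (braid ⊗₁ id)))  ≡⟨ pullˡ lu-natural ⟩
      (braid ∘ lu⇒) ∘ (α⇒ ∘ (braid ⊗₁ id))          ≡⟨ pullʳ (pullˡ lu-assoc) ⟩
      braid ∘ ((lu⇒ ⊗₁ id) ∘ (braid ⊗₁ id))         ≡⟨ cong (braid ∘_) (trans ⊗-merge (cong (_ ⊗₁_) identityˡ)) ⟩
      braid ∘ ((lu⇒ ∘ braid) ⊗₁ id)                 ∎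

  braid-𝟙 : braid {𝟙} {𝟙} ≡ id
  braid-𝟙 = section-cancelˡ ru-isoˡ (trans (trans (cong (_∘ braid) (sym lu≡ru)) lu∘braid) (sym identityʳ))

  α-ru⇐ : ∀ {A B} → α⇒ {A} {𝟙} {B} ∘ (ru⇐ ⊗₁ id) ≡ id ⊗₁ lu⇐
  α-ru⇐ = section-cancelˡ id⊗lu-retraction (begin
    (id ⊗₁ lu⇒) ∘ (α⇒ ∘ (ru⇐ ⊗₁ id))  ≡⟨ pullˡ triangle ⟩
    (ru⇒ ⊗₁ id) ∘ (ru⇐ ⊗₁ id)         ≡⟨ trans ⊗-merge (trans (cong₂ _⊗₁_ ru-isoʳ identityˡ) ⊗-id) ⟩
    id                                ≡⟨ sym (trans ⊗-merge (trans (cong₂ _⊗₁_ identityˡ lu-isoʳ) ⊗-id)) ⟩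
    (id ⊗₁ lu⇒) ∘ (id ⊗₁ lu⇐)         ∎)
    where
    id⊗lu-retraction : ∀ {A B} → (id ⊗₁ lu⇐) ∘ (id ⊗₁ lu⇒) ≡ id {A ⊗₀ (𝟙 ⊗₀ B)}
    id⊗lu-retraction = trans ⊗-merge (trans (cong₂ _⊗₁_ identityˡ lu-isoˡ) ⊗-id)

  infixr 10 _⊠_
  _⊠_ : ∀ {A B} → 𝟙 ⇒ A → 𝟙 ⇒ B → 𝟙 ⇒ A ⊗₀ B
  a ⊠ b = (a ⊗₁ b) ∘ ru⇐

  ⊗-⊠ : ∀ {A B C D} {f : A ⇒ C} {g : B ⇒ D} {a : 𝟙 ⇒ A} {b : 𝟙 ⇒ B} →
        (f ⊗₁ g) ∘ (a ⊠ b) ≡ (f ∘ a) ⊠ (g ∘ b)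
  ⊗-⊠ = trans (sym assoc) (cong (_∘ ru⇐) ⊗-merge)

  ru⇒-⊠id : ∀ {A} {a : 𝟙 ⇒ A} → ru⇒ ∘ (a ⊠ id) ≡ a
  ru⇒-⊠id = trans (pullˡ ru-natural) (trans (pullʳ ru-isoʳ) identityʳ)

  lu⇒-id⊠ : ∀ {A} {a : 𝟙 ⇒ A} → lu⇒ ∘ (id ⊠ a) ≡ a
  lu⇒-id⊠ = trans (pullˡ lu-natural) (trans (pullʳ lu⇒∘ru⇐) identityʳ)

  ⊠-zeroʳ : ∀ {A B} {a : 𝟙 ⇒ A} → a ⊠ 0# {𝟙} {B} ≡ 0#
  ⊠-zeroʳ = trans (cong (_∘ ru⇐) ⊗-0) 0-∘

  ⊠-zeroˡ : ∀ {A B} {b : 𝟙 ⇒ B} → 0# {𝟙} {A} ⊠ b ≡ 0#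
  ⊠-zeroˡ = trans (cong (_∘ ru⇐) 0-⊗) 0-∘

  braid-⊠ : ∀ {A B} {a : 𝟙 ⇒ A} {b : 𝟙 ⇒ B} → braid ∘ (a ⊠ b) ≡ b ⊠ a
  braid-⊠ = trans (pullˡ braid-natural) (pullʳ (trans (cong (_∘ ru⇐) braid-𝟙) identityˡ))

  α-⊠ : ∀ {A B C} {a : 𝟙 ⇒ A} {b : 𝟙 ⇒ B} {c : 𝟙 ⇒ C} → α⇒ ∘ ((a ⊠ b) ⊠ c) ≡ a ⊠ (b ⊠ c)
  α-⊠ {a = a} {b} {c} = begin
    α⇒ ∘ ((((a ⊗₁ b) ∘ ru⇐) ⊗₁ c) ∘ ru⇐)
      ≡⟨ cong (λ z → α⇒ ∘ (z ∘ ru⇐)) (trans (cong (_ ⊗₁_) (sym identityʳ)) ⊗-∘) ⟩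
    α⇒ ∘ ((((a ⊗₁ b) ⊗₁ c) ∘ (ru⇐ ⊗₁ id)) ∘ ru⇐)    ≡⟨ cong (α⇒ ∘_) assoc ⟩
    α⇒ ∘ (((a ⊗₁ b) ⊗₁ c) ∘ ((ru⇐ ⊗₁ id) ∘ ru⇐))    ≡⟨ pullˡ α-natural ⟩
    ((a ⊗₁ (b ⊗₁ c)) ∘ α⇒) ∘ ((ru⇐ ⊗₁ id) ∘ ru⇐)    ≡⟨ pullʳ (pullˡ α-ru⇐) ⟩
    (a ⊗₁ (b ⊗₁ c)) ∘ ((id ⊗₁ lu⇐) ∘ ru⇐)           ≡⟨ sym assoc ⟩
    ((a ⊗₁ (b ⊗₁ c)) ∘ (id ⊗₁ lu⇐)) ∘ ru⇐           ≡⟨ cong (_∘ ru⇐) (trans ⊗-merge (cong₂ _⊗₁_ identityʳ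
                                                        (cong ((b ⊗₁ c) ∘_) lu⇐≡ru⇐))) ⟩
    (a ⊗₁ ((b ⊗₁ c) ∘ ru⇐)) ∘ ru⇐                    ∎

  ⊠-as-∘ˡ : ∀ {A B} {x : 𝟙 ⇒ A} {b : 𝟙 ⇒ B} → x ⊠ b ≡ ((id ⊗₁ b) ∘ ru⇐) ∘ x
  ⊠-as-∘ˡ = trans (cong (_∘ ru⇐) (sym ⊗-splitʳ))
              (trans assoc (trans (cong (_ ∘_) (sym ru⇐-natural)) (sym assoc)))

  ⊠-as-∘ʳ : ∀ {A B} {a : 𝟙 ⇒ A} {y : 𝟙 ⇒ B} → a ⊠ y ≡ ((a ⊗₁ id) ∘ lu⇐) ∘ y
  ⊠-as-∘ʳ = trans (cong (_∘ ru⇐) (sym ⊗-splitˡ))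
             (trans assoc (trans (cong (λ z → _ ∘ ((id ⊗₁ _) ∘ z)) (sym lu⇐≡ru⇐))
               (trans (cong (_ ∘_) (sym lu⇐-natural)) (sym assoc))))

module ExponentialProperties {o ℓ} (𝓛 : Setting o ℓ) where
  open Setting 𝓛
  open Derived 𝓛
  open MonoidalProperties 𝓛
  open ≡-Reasoning

  bar-curry : ∀ (φ : 𝟙 ⇒ I) {X Y} (k : Y ⊗₀ I ⇒ X) → bar φ ∘ curry k ≡ k ∘ ((id ⊗₁ φ) ∘ ru⇐)
  bar-curry φ k = begin
    (ev ∘ ((id ⊗₁ φ) ∘ ru⇐)) ∘ curry k           ≡⟨ pullʳ assoc ⟩
    ev ∘ ((id ⊗₁ φ) ∘ (ru⇐ ∘ curry k))           ≡⟨ cong (λ z → ev ∘ ((id ⊗₁ φ) ∘ z)) ru⇐-natural ⟩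
    ev ∘ ((id ⊗₁ φ) ∘ ((curry k ⊗₁ id) ∘ ru⇐))   ≡⟨ cong (ev ∘_) (sym assoc) ⟩
    ev ∘ (((id ⊗₁ φ) ∘ (curry k ⊗₁ id)) ∘ ru⇐)   ≡⟨ cong (λ z → ev ∘ (z ∘ ru⇐)) (trans ⊗-splitʳ (sym ⊗-splitˡ)) ⟩
    ev ∘ (((curry k ⊗₁ id) ∘ (id ⊗₁ φ)) ∘ ru⇐)   ≡⟨ cong (ev ∘_) assoc ⟩
    ev ∘ ((curry k ⊗₁ id) ∘ ((id ⊗₁ φ) ∘ ru⇐))   ≡⟨ pullˡ ev-curry ⟩
    k ∘ ((id ⊗₁ φ) ∘ ru⇐)                        ∎

  bar-curry-lu : ∀ (φ : 𝟙 ⇒ I) {X} (f : I ⇒ X) → bar φ ∘ curry (f ∘ lu⇒) ≡ f ∘ φ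
  bar-curry-lu φ f = begin
    bar φ ∘ curry (f ∘ lu⇒)        ≡⟨ bar-curry φ (f ∘ lu⇒) ⟩
    (f ∘ lu⇒) ∘ ((id ⊗₁ φ) ∘ ru⇐)  ≡⟨ pullʳ (pullˡ lu-natural) ⟩
    f ∘ ((φ ∘ lu⇒) ∘ ru⇐)          ≡⟨ cong (f ∘_) (trans (pullʳ lu⇒∘ru⇐) identityʳ) ⟩
    f ∘ φ                          ∎

  bar-natural : ∀ (φ : 𝟙 ⇒ I) {X Y Z} (f : X ⇒ Y) (h : Z ⇒ S X) → bar φ ∘ (S₁ f ∘ h) ≡ f ∘ (bar φ ∘ h)
  bar-natural φ f h = trans (sym assoc) (trans (cong (_∘ h) (trans (bar-curry φ (f ∘ ev)) assoc)) assoc)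

module PartialSums {o ℓ} (𝓛 : Setting o ℓ) (cs : Derived.CanonicallySummable 𝓛) where
  open Setting 𝓛
  open Derived 𝓛
  open CanonicallySummable cs
  open MonoidalProperties 𝓛
  open ExponentialProperties 𝓛

  w-jointly-epic : ∀ {X} {f g : I ⇒ X} → f ∘ w₀ ≡ g ∘ w₀ → f ∘ w₁ ≡ g ∘ w₁ → f ≡ g
  w-jointly-epic {f = f} {g} e₀ e₁ = retraction-cancelʳ lu-isoʳ
    (trans (sym ev-curry) (trans (cong (λ z → ev ∘ (z ⊗₁ id)) curry-lu-equal) ev-curry))
    where
    curry-lu-equal : curry (f ∘ lu⇒) ≡ curry (g ∘ lu⇒)
    curry-lu-equal = π-jointly-monic
      (trans (bar-curry-lu w₀ f) (trans e₀ (sym (bar-curry-lu w₀ g))))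
      (trans (bar-curry-lu w₁ f) (trans e₁ (sym (bar-curry-lu w₁ g))))

  HasSum : ∀ {X Y} → X ⇒ Y → X ⇒ Y → X ⇒ Y → Set ℓ
  HasSum {X} {Y} x y s = Σ (X ⇒ S Y) λ h → IsWitness x y h × σ ∘ h ≡ s

  summable-hasSum : ∀ {X Y} {x y : X ⇒ Y} (p : Summable x y) → HasSum x y (sum p)
  summable-hasSum (h , w) = h , w , refl

  witness-hasSum : ∀ {X Y} (h : X ⇒ S Y) → HasSum (π₀ ∘ h) (π₁ ∘ h) (σ ∘ h)
  witness-hasSum h = h , (refl , refl) , refl

  hasSum-resp : ∀ {X Y} {x x′ y y′ s s′ : X ⇒ Y} → x ≡ x′ → y ≡ y′ → s ≡ s′ →
                HasSum x y s → HasSum x′ y′ s′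
  hasSum-resp refl refl refl p = p

  hasSum-unique : ∀ {X Y} {x y s t : X ⇒ Y} → HasSum x y s → HasSum x y t → s ≡ t
  hasSum-unique (h , (p₀ , p₁) , refl) (h′ , (q₀ , q₁) , refl) =
    cong (σ ∘_) (π-jointly-monic (trans p₀ (sym q₀)) (trans p₁ (sym q₁)))

  hasSum-comm : ∀ {X Y} {x y s : X ⇒ Y} → HasSum x y s → HasSum y x s
  hasSum-comm (h , w , refl) with S-com (h , w)
  ... | p , e = hasSum-resp refl refl (sym e) (summable-hasSum p)

  hasSum-identityʳ : ∀ {X Y} (x : X ⇒ Y) → HasSum x 0# x
  hasSum-identityʳ x with S-zero x
  ... | p , e = hasSum-resp refl refl e (summable-hasSum p)

  hasSum-identityˡ : ∀ {X Y} (x : X ⇒ Y) → HasSum 0# x x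
  hasSum-identityˡ x = hasSum-comm (hasSum-identityʳ x)

  hasSum-∘ˡ : ∀ {X Y Z} {x y s : X ⇒ Y} (k : Y ⇒ Z) → HasSum x y s → HasSum (k ∘ x) (k ∘ y) (k ∘ s)
  hasSum-∘ˡ k (h , (refl , refl) , refl) =
    S₁ k ∘ h , (bar-natural w₀ k h , bar-natural w₁ k h) , bar-natural Δ k h

  hasSum-⊠ʳ : ∀ {A B} {x y s : 𝟙 ⇒ A} (b : 𝟙 ⇒ B) → HasSum x y s → HasSum (x ⊠ b) (y ⊠ b) (s ⊠ b)
  hasSum-⊠ʳ b p = hasSum-resp (sym ⊠-as-∘ˡ) (sym ⊠-as-∘ˡ) (sym ⊠-as-∘ˡ) (hasSum-∘ˡ _ p)

  hasSum-⊠ˡ : ∀ {A B} {x y s : 𝟙 ⇒ B} (a : 𝟙 ⇒ A) → HasSum x y s → HasSum (a ⊠ x) (a ⊠ y) (a ⊠ s)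
  hasSum-⊠ˡ a p = hasSum-resp (sym ⊠-as-∘ʳ) (sym ⊠-as-∘ʳ) (sym ⊠-as-∘ʳ) (hasSum-∘ˡ _ p)

  -- (S-witness) applied to x + y and z + 0 yields a 2 × 2 matrix of witnesses;
  -- summing it the other way round, by naturality of σ, gives (x + z) + y.
  hasSum-rotate : ∀ {X Y} {x y z xy s : X ⇒ Y} → HasSum x y xy → HasSum xy z s →
                  ∃ λ xz → HasSum x z xz × HasSum xz y s
  hasSum-rotate {x = x} {y} {z} (hxy , wxy , refl) (h , (h₀ , h₁) , refl)
    with S-zero z
  ... | (hz , wz) , ez with S-witness (hxy , wxy) (hz , wz) (h , h₀ , trans h₁ (sym ez))
  ... | W , (W₀ , W₁) = π₀ ∘ (σ ∘ W) , x+z , xz+y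
    where
    x+z : HasSum x z (π₀ ∘ (σ ∘ W))
    x+z = hasSum-resp (trans (cong (π₀ ∘_) W₀) (proj₁ wxy)) (trans (cong (π₀ ∘_) W₁) (proj₁ wz)) refl
                   (hasSum-∘ˡ π₀ (witness-hasSum W))
    y+0≡y : π₁ ∘ (σ ∘ W) ≡ y
    y+0≡y = hasSum-unique
      (hasSum-resp (trans (cong (π₁ ∘_) W₀) (proj₂ wxy)) (trans (cong (π₁ ∘_) W₁) (proj₂ wz)) refl
        (hasSum-∘ˡ π₁ (witness-hasSum W)))
      (hasSum-identityʳ y)
    total : σ ∘ (σ ∘ W) ≡ σ ∘ h
    total = hasSum-unique
      (hasSum-resp (cong (σ ∘_) W₀) (trans (cong (σ ∘_) W₁) ez) refl (hasSum-∘ˡ σ (witness-hasSum W)))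
      (h , (h₀ , h₁) , refl)
    xz+y : HasSum (π₀ ∘ (σ ∘ W)) y (σ ∘ h)
    xz+y = hasSum-resp refl y+0≡y total (witness-hasSum (σ ∘ W))

  hasSum-assoc : ∀ {X Y} {a b c ab bc s t : X ⇒ Y} →
                 HasSum b c bc → HasSum a bc s → HasSum a b ab → HasSum ab c t → s ≡ t
  hasSum-assoc b+c a+bc a+b ab+c with hasSum-rotate b+c (hasSum-comm a+bc)
  ... | ba , b+a , ba+c =
    hasSum-unique (hasSum-resp (hasSum-unique (hasSum-comm b+a) a+b) refl refl ba+c) ab+c

module ComonoidL {o ℓ} (𝓛 : Setting o ℓ) where
  open Setting 𝓛
  open Derived 𝓛
  open MonoidalProperties 𝓛

  module Laws (cs : CanonicallySummable) (s : Summable ((w₀ ⊗₁ w₁) ∘ ru⇐) ((w₁ ⊗₁ w₀) ∘ ru⇐))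
              (𝖫 : I ⇒ I ⊗₀ I) (isL : IsL 𝖫 s) where
    open PartialSums 𝓛 cs

    ∘𝖫∘w₀ : ∀ {Z} (k : I ⊗₀ I ⇒ Z) → (k ∘ 𝖫) ∘ w₀ ≡ k ∘ (w₀ ⊠ w₀)
    ∘𝖫∘w₀ k = pullʳ (proj₁ isL)

    𝖫∘w₁-hasSum : HasSum (w₀ ⊠ w₁) (w₁ ⊠ w₀) (𝖫 ∘ w₁)
    𝖫∘w₁-hasSum = hasSum-resp refl refl (sym (proj₂ isL)) (summable-hasSum s)

    ∘𝖫∘w₁-hasSum : ∀ {Z} (k : I ⊗₀ I ⇒ Z) → HasSum (k ∘ (w₀ ⊠ w₁)) (k ∘ (w₁ ⊠ w₀)) ((k ∘ 𝖫) ∘ w₁)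
    ∘𝖫∘w₁-hasSum k = hasSum-resp refl refl (sym assoc) (hasSum-∘ˡ k 𝖫∘w₁-hasSum)

    counitʳ : ru⇒ ∘ ((id ⊗₁ pr₀) ∘ 𝖫) ≡ id
    counitʳ = trans (sym assoc) (w-jointly-epic onW₀ onW₁)
      where
      k : I ⊗₀ I ⇒ I
      k = ru⇒ ∘ (id ⊗₁ pr₀)
      k-⊠ : ∀ {a b : 𝟙 ⇒ I} → k ∘ (a ⊠ b) ≡ ru⇒ ∘ (a ⊠ (pr₀ ∘ b))
      k-⊠ = trans (pullʳ ⊗-⊠) (cong (λ z → ru⇒ ∘ (z ⊠ _)) identityˡ)
      k-⊠w₀ : ∀ {a : 𝟙 ⇒ I} → k ∘ (a ⊠ w₀) ≡ a
      k-⊠w₀ = trans k-⊠ (trans (cong (λ z → ru⇒ ∘ (_ ⊠ z)) pr₀-β) ru⇒-⊠id)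
      k-⊠w₁ : ∀ {a : 𝟙 ⇒ I} → k ∘ (a ⊠ w₁) ≡ 0#
      k-⊠w₁ = trans k-⊠ (trans (cong (λ z → ru⇒ ∘ (_ ⊠ z)) pr₀-β) (trans (cong (ru⇒ ∘_) ⊠-zeroʳ) ∘-0))
      onW₀ : (k ∘ 𝖫) ∘ w₀ ≡ id ∘ w₀
      onW₀ = trans (∘𝖫∘w₀ k) (trans k-⊠w₀ (sym identityˡ))
      onW₁ : (k ∘ 𝖫) ∘ w₁ ≡ id ∘ w₁
      onW₁ = trans (hasSum-unique (hasSum-resp k-⊠w₁ k-⊠w₀ refl (∘𝖫∘w₁-hasSum k)) (hasSum-identityˡ w₁))
                   (sym identityˡ)

    counitˡ : lu⇒ ∘ ((pr₀ ⊗₁ id) ∘ 𝖫) ≡ id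
    counitˡ = trans (sym assoc) (w-jointly-epic onW₀ onW₁)
      where
      k : I ⊗₀ I ⇒ I
      k = lu⇒ ∘ (pr₀ ⊗₁ id)
      k-⊠ : ∀ {a b : 𝟙 ⇒ I} → k ∘ (a ⊠ b) ≡ lu⇒ ∘ ((pr₀ ∘ a) ⊠ b)
      k-⊠ = trans (pullʳ ⊗-⊠) (cong (λ z → lu⇒ ∘ (_ ⊠ z)) identityˡ)
      k-w₀⊠ : ∀ {b : 𝟙 ⇒ I} → k ∘ (w₀ ⊠ b) ≡ b
      k-w₀⊠ = trans k-⊠ (trans (cong (λ z → lu⇒ ∘ (z ⊠ _)) pr₀-β) lu⇒-id⊠)
      k-w₁⊠ : ∀ {b : 𝟙 ⇒ I} → k ∘ (w₁ ⊠ b) ≡ 0#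
      k-w₁⊠ = trans k-⊠ (trans (cong (λ z → lu⇒ ∘ (z ⊠ _)) pr₀-β) (trans (cong (lu⇒ ∘_) ⊠-zeroˡ) ∘-0))
      onW₀ : (k ∘ 𝖫) ∘ w₀ ≡ id ∘ w₀
      onW₀ = trans (∘𝖫∘w₀ k) (trans k-w₀⊠ (sym identityˡ))
      onW₁ : (k ∘ 𝖫) ∘ w₁ ≡ id ∘ w₁
      onW₁ = trans (hasSum-unique (hasSum-resp k-w₀⊠ k-w₁⊠ refl (∘𝖫∘w₁-hasSum k)) (hasSum-identityʳ w₁))
                   (sym identityˡ)

    cocomm : braid ∘ 𝖫 ≡ 𝖫
    cocomm = w-jointly-epic onW₀ onW₁
      where
      onW₀ : (braid ∘ 𝖫) ∘ w₀ ≡ 𝖫 ∘ w₀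
      onW₀ = trans (∘𝖫∘w₀ braid) (trans braid-⊠ (sym (proj₁ isL)))
      onW₁ : (braid ∘ 𝖫) ∘ w₁ ≡ 𝖫 ∘ w₁
      onW₁ = hasSum-unique (hasSum-resp braid-⊠ braid-⊠ refl (∘𝖫∘w₁-hasSum braid))
                           (hasSum-comm 𝖫∘w₁-hasSum)

    coassoc : α⇒ ∘ ((𝖫 ⊗₁ id) ∘ 𝖫) ≡ (id ⊗₁ 𝖫) ∘ 𝖫
    coassoc = trans (sym assoc) (w-jointly-epic onW₀ onW₁)
      where
      kₗ : I ⊗₀ I ⇒ I ⊗₀ (I ⊗₀ I)
      kₗ = α⇒ ∘ (𝖫 ⊗₁ id)
      kₗ-⊠ : ∀ {a b : 𝟙 ⇒ I} → kₗ ∘ (a ⊠ b) ≡ α⇒ ∘ ((𝖫 ∘ a) ⊠ b)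
      kₗ-⊠ = trans (pullʳ ⊗-⊠) (cong (λ z → α⇒ ∘ (_ ⊠ z)) identityˡ)
      kᵣ-⊠ : ∀ {a b : 𝟙 ⇒ I} → (id ⊗₁ 𝖫) ∘ (a ⊠ b) ≡ a ⊠ (𝖫 ∘ b)
      kᵣ-⊠ = trans ⊗-⊠ (cong (_⊠ _) identityˡ)
      kₗ-w₀⊠ : ∀ {b : 𝟙 ⇒ I} → kₗ ∘ (w₀ ⊠ b) ≡ w₀ ⊠ (w₀ ⊠ b)
      kₗ-w₀⊠ = trans kₗ-⊠ (trans (cong (λ z → α⇒ ∘ (z ⊠ _)) (proj₁ isL)) α-⊠)
      kᵣ-w₁⊠w₀ : (id ⊗₁ 𝖫) ∘ (w₁ ⊠ w₀) ≡ w₁ ⊠ (w₀ ⊠ w₀)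
      kᵣ-w₁⊠w₀ = trans kᵣ-⊠ (cong (w₁ ⊠_) (proj₁ isL))
      onW₀ : (kₗ ∘ 𝖫) ∘ w₀ ≡ ((id ⊗₁ 𝖫) ∘ 𝖫) ∘ w₀
      onW₀ = trans (∘𝖫∘w₀ kₗ) (trans kₗ-w₀⊠ (sym (trans (∘𝖫∘w₀ (id ⊗₁ 𝖫)) (trans kᵣ-⊠ (cong (w₀ ⊠_) (proj₁ isL))))))
      b+c : HasSum (w₀ ⊠ (w₁ ⊠ w₀)) (w₁ ⊠ (w₀ ⊠ w₀)) (α⇒ ∘ ((𝖫 ∘ w₁) ⊠ w₀))
      b+c = hasSum-resp α-⊠ α-⊠ refl (hasSum-∘ˡ α⇒ (hasSum-⊠ʳ w₀ 𝖫∘w₁-hasSum))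
      a+bc : HasSum (w₀ ⊠ (w₀ ⊠ w₁)) (α⇒ ∘ ((𝖫 ∘ w₁) ⊠ w₀)) ((kₗ ∘ 𝖫) ∘ w₁)
      a+bc = hasSum-resp kₗ-w₀⊠ kₗ-⊠ refl (∘𝖫∘w₁-hasSum kₗ)
      a+b : HasSum (w₀ ⊠ (w₀ ⊠ w₁)) (w₀ ⊠ (w₁ ⊠ w₀)) (w₀ ⊠ (𝖫 ∘ w₁))
      a+b = hasSum-⊠ˡ w₀ 𝖫∘w₁-hasSum
      ab+c : HasSum (w₀ ⊠ (𝖫 ∘ w₁)) (w₁ ⊠ (w₀ ⊠ w₀)) (((id ⊗₁ 𝖫) ∘ 𝖫) ∘ w₁)
      ab+c = hasSum-resp kᵣ-⊠ kᵣ-w₁⊠w₀ refl (∘𝖫∘w₁-hasSum (id ⊗₁ 𝖫))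
      onW₁ : (kₗ ∘ 𝖫) ∘ w₁ ≡ ((id ⊗₁ 𝖫) ∘ 𝖫) ∘ w₁
      onW₁ = hasSum-assoc b+c a+bc a+b ab+c

mainTheorem12 : ∀ {o ℓ} (𝓛 : Setting o ℓ) →
    let open Setting 𝓛 in let open Derived 𝓛 in
    CanonicallySummable →
    (s : Summable ((w₀ ⊗₁ w₁) ∘ ru⇐) ((w₁ ⊗₁ w₀) ∘ ru⇐)) →
    (𝖫 : I ⇒ (I ⊗₀ I)) → IsL 𝖫 s →
    IsCocommutativeComonoid I pr₀ 𝖫
mainTheorem12 𝓛 cs s 𝖫 isL = record
  { counitˡ = counitˡ ; counitʳ = counitʳ ; coassoc = coassoc ; cocomm = cocomm }
  where open ComonoidL.Laws 𝓛 cs s 𝖫 isL
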